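{- Let $G$ be a finite simple graph, let $\beta$ be a solution to the Naji system for $G$, and let $H$ be an induced subgraph of $G$ isomorphic to $K_4$ such that the restriction of $\beta$ to $V(H)$ is not chordal. Then for each split $(X,Y)$ in $H$ there is a split $(X',Y')$ in $G$ with $X\subseteq X'$ and $Y\subseteq Y'$.
   Context: The Naji system of a graph $G=(V,E)$ has unknowns $\beta(u,v)\in\mathbb{F}_2$ for each ordered pair of distinct vertices, and equations: $\beta(v,w)+\beta(w,v)=1$ for each edge $vw$; $\beta(x,v)+\beta(x,w)=0$ for each triple of distinct vertices $(x,v,w)$ with $vw\in E$, $xv,xw\notin E$; $\beta(v,w)+\beta(w,v)+\beta(x,v)+\beta(x,w)=1$ for each triple of distinct vertices $(x,v,w)$ with $xv,xw\in E$, $vw\notin E$. An oriented chord diagram is a circle with finitely many oriented chords (tail and head) with pairwise distinct endpoints. For an oriented chord diagram $\vec{\mathcal C}$ whose intersection graph is a graph $H$ (chords identified with vertices, adjacent iff crossing), $\beta_{\vec{\mathcal C}}(v,w)=0$ if the head of $w$ is encountered travelling clockwise from the head of $v$ to the tail of $v$, and $1$ otherwise. A solution $\beta'$ of the Naji system of $H$ is chordal if $\beta'=\beta_{\vec{\mathcal C}}$ for some such diagram. A split in a graph is a partition $(X,Y)$ of its vertex set with $|X|,|Y|\ge2$ such that the edges between $X$ and $Y$ induce a complete bipartite graph. -}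

module Defs where

open import Data.Nat using (ℕ; _≤_; _<ᵇ_)
open import Data.Bool using (Bool; true; false; _xor_; _∧_; _∨_; not; if_then_else_)
open import Data.Fin using (Fin)
open import Data.Fin.Subset using (Subset; _∈_; ∁; ∣_∣)
open import Data.Product using (Σ; _×_; ∃; ∃-syntax; _,_)
open import Relation.Binary.PropositionalEquality using (_≡_; _≢_)
open import Relation.Nullary using (¬_)
open import Function.Definitions using (Injective)

record Graph (n : ℕ) : Set where
  field
    adj   : Fin n → Fin n → Bool
    sym   : ∀ u v → adj u v ≡ adj v u
    irrefl : ∀ v → adj v v ≡ false
open Graph public

-- β : ordered pairs → 𝔽₂ (= Bool with xor); diagonal values are irrelevant.
-- Solution of the Naji system of G.
record NajiSolution {n : ℕ} (G : Graph n) (β : Fin n → Fin n → Bool) : Set where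
  field
    eqEdge : ∀ v w → adj G v w ≡ true → (β v w xor β w v) ≡ true
    eqOut  : ∀ x v w → x ≢ v → x ≢ w → v ≢ w →
             adj G v w ≡ true → adj G x v ≡ false → adj G x w ≡ false →
             (β x v xor β x w) ≡ false
    eqIn   : ∀ x v w → x ≢ v → x ≢ w → v ≢ w →
             adj G x v ≡ true → adj G x w ≡ true → adj G v w ≡ false →
             ((β v w xor β w v) xor (β x v xor β x w)) ≡ true

-- The circle is cut at a
-- point which is not an endpoint; endpoints are then recorded by distinct
-- natural numbers increasing in the clockwise direction.
-- endpoint (c , true) = head of c, endpoint (c , false) = tail of c.
record ChordDiagram (k : ℕ) : Set where
  field
    endpoint : Fin k × Bool → ℕ
    distinct : Injective _≡_ _≡_ endpoint
  head tail : Fin k → ℕ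
  head c = endpoint (c , true)
  tail c = endpoint (c , false)
open ChordDiagram public

-- p is encountered (strictly) when travelling clockwise from a to b (a ≠ b).
inArc : ℕ → ℕ → ℕ → Bool
inArc a b p = if a <ᵇ b then ((a <ᵇ p) ∧ (p <ᵇ b)) else ((a <ᵇ p) ∨ (p <ᵇ b))

crosses : ∀ {k} → ChordDiagram k → Fin k → Fin k → Bool
crosses D v w = inArc (head D v) (tail D v) (head D w) xor inArc (head D v) (tail D v) (tail D w)

βC : ∀ {k} → ChordDiagram k → Fin k → Fin k → Bool
βC D v w = not (inArc (head D v) (tail D v) (head D w))

InducedK4 : ∀ {n} → Graph n → (Fin 4 → Fin n) → Set
InducedK4 G e = Injective _≡_ _≡_ e × (∀ i j → i ≢ j → adj G (e i) (e j) ≡ true)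

-- The restriction of β to V(H) (H = induced subgraph on image of e, chords
-- identified with the vertices of H via e) is chordal.
ChordalOn : ∀ {n} → Graph n → (Fin n → Fin n → Bool) → (Fin 4 → Fin n) → Set
ChordalOn G β e = Σ (ChordDiagram 4) λ D →
  (∀ i j → i ≢ j → crosses D i j ≡ adj G (e i) (e j)) ×
  (∀ i j → i ≢ j → β (e i) (e j) ≡ βC D i j)

-- A split of a graph on Fin m with adjacency adj, given as (X, ∁ X):
-- both sides have ≥ 2 vertices, and the edges between X and ∁ X induce a
-- complete bipartite graph: every vertex of X incident to a crossing edge is
-- adjacent to every vertex of ∁ X incident to a crossing edge.
IsSplit : ∀ {m} → (Fin m → Fin m → Bool) → Subset m → Set
IsSplit {m} a X =
  2 ≤ ∣ X ∣ × 2 ≤ ∣ ∁ X ∣ ×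
  (∀ x y → x ∈ X → y ∈ ∁ X →
     (∃[ y' ] (y' ∈ ∁ X × a x y' ≡ true)) →
     (∃[ x' ] (x' ∈ X × a x' y ≡ true)) →
     a x y ≡ true)

module Submission where

-- Write  view P Q u = β(P,u) + β(Q,u)  for the bit with which the pair P, Q sees u.
--  1. K₄ dichotomy.  Enumerating the 64 orientations of K₄ and the 48 chord
--     diagrams of K₄ up to rotation shows that β on H is chordal unless it has the
--     parity property: for distinct p q r s, the pair (e p, e q) sees e r and e s
--     differently.
--  2. Two local consequences of the Naji equations: adjacent P, Q see u and v alike
--     (a) across an edge uv if both miss u and v sees both or neither, and
--     (b) across a non-edge uv if both are common neighbours of u and v.
--  3. A vertex u represents the index r if it avoids H − e r, is adjacent to all or
--     to none of H − e r, and every pair from H − e r sees u as it sees e r.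
--     By parity, representatives of different indices are told apart; every vertex
--     outside H is uniform on H − e r or represents an index other than r; and
--     representation of r spreads along edges from a vertex missing H − e r.
--  4. Y' := vertices representing an index in Y, X' := its complement.  Since e r
--     represents r, (X', Y') extends (X, Y), and 3. makes X'–Y' complete bipartite.

open import Defs hiding (sym)
open import Data.Nat using (ℕ; suc; _+_; _≤_; z≤n; s≤s)
open import Data.Nat.Properties using (≤-trans) renaming (_≟_ to _≟ℕ_)
open import Data.Bool using (Bool; true; false; not; _xor_; if_then_else_)
open import Data.Bool.Properties using () renaming (_≟_ to _≟ᵇ_)
open import Data.Fin using (Fin; zero; suc)
open import Data.Fin.Patterns using (0F; 1F; 2F; 3F)
open import Data.Fin.Properties using (_≟_; all?; any?; suc-injective)
open import Data.Fin.Subset using (Subset; _∈_; _∉_; ∁; ∣_∣)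
open import Data.Fin.Subset.Properties
  using (_∈?_; x∈p⇒x∉∁p; x∈∁p⇒x∉p; x∉p⇒x∈∁p; x∈p⇒∣p-x∣<∣p∣; x∈p∧x≢y⇒x∈p-y)
open import Data.Vec using (Vec; []; _∷_; lookup; tabulate; here; there)
open import Data.Vec.Properties using (lookup∘tabulate; []=⇒lookup; lookup⇒[]=)
open import Data.List using (List; []; _∷_; map; concatMap)
open import Data.List.Relation.Unary.All as All using (All)
open import Data.List.Relation.Unary.Any as Any using (Any)
open import Data.List.Membership.Propositional using (mapWith∈)
open import Data.Product using (Σ; ∃; ∃₂; _×_; _,_; proj₁; proj₂)
open import Data.Product.Properties using (≡-dec)
open import Data.Sum using (_⊎_; inj₁; inj₂)
open import Data.Empty using (⊥; ⊥-elim)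
open import Function using (_∘_)
open import Function.Definitions using (Injective)
open import Relation.Binary.PropositionalEquality
  using (_≡_; _≢_; refl; sym; trans; cong; cong₂; ≢-sym; module ≡-Reasoning)
open import Relation.Nullary using (¬_; Dec; yes; no; contradiction)
open import Relation.Nullary.Decidable
  using (does; map′; _×-dec_; _⊎-dec_; _→-dec_; ¬?; from-yes; True; toWitness; dec-true; dec-false; decidable-stable)

open ≡-Reasoning

∀-Bool? : {P : Bool → Set} → ((b : Bool) → Dec (P b)) → Dec ((b : Bool) → P b)
∀-Bool? P? = map′ (λ { (f , t) false → f ; (f , t) true → t }) (λ h → h false , h true)
                  (P? false ×-dec P? true)

∃-Bool? : {P : Bool → Set} → ((b : Bool) → Dec (P b)) → Dec (Σ Bool P)
∃-Bool? P? = map′ (λ { (inj₁ f) → false , f ; (inj₂ t) → true , t })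
                  (λ { (false , f) → inj₁ f ; (true , t) → inj₂ t })
                  (P? false ⊎-dec P? true)

∀-Vec? : ∀ k {P : Vec Bool k → Set} → ((v : Vec Bool k) → Dec (P v)) → Dec ((v : Vec Bool k) → P v)
∀-Vec? 0       P? = map′ (λ { p [] → p }) (λ h → h []) (P? [])
∀-Vec? (suc k) P? = map′ (λ { h (b ∷ v) → h b v }) (λ h b v → h (b ∷ v))
                         (∀-Bool? λ b → ∀-Vec? k λ v → P? (b ∷ v))

allVecs : ∀ k → List (Vec Bool k)
allVecs 0       = [] ∷ []
allVecs (suc k) = concatMap (λ v → (false ∷ v) ∷ (true ∷ v) ∷ []) (allVecs k)

xor≡false⇒≡ : ∀ x y → x xor y ≡ false → x ≡ y
xor≡false⇒≡ false false _ = refl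
xor≡false⇒≡ true  true  _ = refl

xor≡true⇒≡not : ∀ {c s} → c xor s ≡ true → s ≡ not c
xor≡true⇒≡not {false}          c+s = c+s
xor≡true⇒≡not {true}  {false} _   = refl

xor-swap : ∀ a b c d → a xor b ≡ c xor d → a xor c ≡ b xor d
xor-swap = from-yes (∀-Bool? λ a → ∀-Bool? λ b → ∀-Bool? λ c → ∀-Bool? λ d →
  (a xor b ≟ᵇ c xor d) →-dec (a xor c ≟ᵇ b xor d))

-- The combination of two Naji equations used in shift-pendant below.
pendant-law : ∀ a b c d e → (a xor b) xor (c xor d) ≡ true → d xor e ≡ true → b xor e ≡ a xor c
pendant-law = from-yes (∀-Bool? λ a → ∀-Bool? λ b → ∀-Bool? λ c → ∀-Bool? λ d → ∀-Bool? λ e →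
  ((a xor b) xor (c xor d) ≟ᵇ true) →-dec ((d xor e ≟ᵇ true) →-dec (b xor e ≟ᵇ a xor c)))

select : ∀ {n} {P : Fin n → Set} → (∀ u → Dec (P u)) → Subset n
select P? = tabulate (does ∘ P?)

∈-select : ∀ {n} {P : Fin n → Set} (P? : ∀ u → Dec (P u)) {u} → P u → u ∈ select P?
∈-select P? {u} pu = lookup⇒[]= u (select P?) (trans (lookup∘tabulate (does ∘ P?) u) (dec-true (P? u) pu))

∈-select⁻ : ∀ {n} {P : Fin n → Set} (P? : ∀ u → Dec (P u)) {u} → u ∈ select P? → P u
∈-select⁻ P? {u} u∈ = decidable-stable (P? u) λ ¬pu →
  contradiction (trans (sym ([]=⇒lookup u∈)) (trans (lookup∘tabulate (does ∘ P?) u) (dec-false (P? u) ¬pu))) λ ()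

member : ∀ {n} {p : Subset n} → 1 ≤ ∣ p ∣ → ∃ (_∈ p)
member {p = true  ∷ p} _ = zero , here
member {p = false ∷ p} h = let x , x∈p = member h in suc x , there x∈p

two-members : ∀ {n} {p : Subset n} → 2 ≤ ∣ p ∣ → ∃₂ λ x y → x ≢ y × x ∈ p × y ∈ p
two-members {p = true ∷ p} (s≤s h) = let y , y∈p = member h in zero , suc y , (λ ()) , here , there y∈p
two-members {p = false ∷ p} h =
  let x , y , x≢y , x∈p , y∈p = two-members h in suc x , suc y , x≢y ∘ suc-injective , there x∈p , there y∈p

two-members⇒2≤∣p∣ : ∀ {n} {p : Subset n} {x y} → x ≢ y → x ∈ p → y ∈ p → 2 ≤ ∣ p ∣
two-members⇒2≤∣p∣ x≢y x∈p y∈p =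
  ≤-trans (s≤s (≤-trans (s≤s z≤n) (x∈p⇒∣p-x∣<∣p∣ (x∈p∧x≢y⇒x∈p-y y∈p (≢-sym x≢y))))) (x∈p⇒∣p-x∣<∣p∣ x∈p)

image-size : ∀ {m n} {f : Fin m → Fin n} → Injective _≡_ _≡_ f → (S : Subset m) {T : Subset n} →
             2 ≤ ∣ S ∣ → (∀ i → i ∈ S → f i ∈ T) → 2 ≤ ∣ T ∣
image-size f-inj S 2≤∣S∣ f[S]⊆T =
  let x , y , x≢y , x∈S , y∈S = two-members 2≤∣S∣
  in two-members⇒2≤∣p∣ (x≢y ∘ f-inj) (f[S]⊆T x x∈S) (f[S]⊆T y y∈S)

record Distinct4 (p q r s : Fin 4) : Set where
  constructor distinct4
  field
    p≢q : p ≢ q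
    p≢r : p ≢ r
    p≢s : p ≢ s
    q≢r : q ≢ r
    q≢s : q ≢ s
    r≢s : r ≢ s

distinct4? : ∀ p q r s → Dec (Distinct4 p q r s)
distinct4? p q r s =
  map′ (λ (a , b , c , d , e , f) → distinct4 a b c d e f)
       (λ (distinct4 a b c d e f) → a , b , c , d , e , f)
       (¬? (p ≟ q) ×-dec ¬? (p ≟ r) ×-dec ¬? (p ≟ s) ×-dec ¬? (q ≟ r) ×-dec ¬? (q ≟ s) ×-dec ¬? (r ≟ s))

distinct-indices : ∀ p q r s → {True (distinct4? p q r s)} → Distinct4 p q r s
distinct-indices p q r s {ok} = toWitness ok

others : ∀ r t → r ≢ t → ∃₂ λ p q → Distinct4 p q r t
others = from-yes (all? λ r → all? λ t → ¬? (r ≟ t) →-dec any? λ p → any? λ q → distinct4? p q r t)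

fin4-elim : {P : Fin 4 → Set} → P 0F → P 1F → P 2F → P 3F → ∀ h → P h
fin4-elim p0 p1 p2 p3 0F = p0
fin4-elim p0 p1 p2 p3 1F = p1
fin4-elim p0 p1 p2 p3 2F = p2
fin4-elim p0 p1 p2 p3 3F = p3

data Shape (f : Fin 4 → Bool) : Set where
  constant : ∀ b → (∀ h → f h ≡ b) → Shape f
  singular : ∀ a b → f a ≡ b → (∀ h → h ≢ a → f h ≡ not b) → Shape f
  balanced : ∀ {p q r s} → Distinct4 p q r s → f p ≡ true → f q ≡ true → f r ≡ false → f s ≡ false → Shape f

shape : ∀ f → Shape f
shape f with f 0F in h0 | f 1F in h1 | f 2F in h2 | f 3F in h3
... | true  | true  | true  | true  = constant true  (fin4-elim h0 h1 h2 h3)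
... | false | false | false | false = constant false (fin4-elim h0 h1 h2 h3)
... | true  | false | false | false = singular 0F true  h0 (fin4-elim (contradiction refl) (λ _ → h1) (λ _ → h2) (λ _ → h3))
... | false | true  | false | false = singular 1F true  h1 (fin4-elim (λ _ → h0) (contradiction refl) (λ _ → h2) (λ _ → h3))
... | false | false | true  | false = singular 2F true  h2 (fin4-elim (λ _ → h0) (λ _ → h1) (contradiction refl) (λ _ → h3))
... | false | false | false | true  = singular 3F true  h3 (fin4-elim (λ _ → h0) (λ _ → h1) (λ _ → h2) (contradiction refl))
... | false | true  | true  | true  = singular 0F false h0 (fin4-elim (contradiction refl) (λ _ → h1) (λ _ → h2) (λ _ → h3))
... | true  | false | true  | true  = singular 1F false h1 (fin4-elim (λ _ → h0) (contradiction refl) (λ _ → h2) (λ _ → h3))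
... | true  | true  | false | true  = singular 2F false h2 (fin4-elim (λ _ → h0) (λ _ → h1) (contradiction refl) (λ _ → h3))
... | true  | true  | true  | false = singular 3F false h3 (fin4-elim (λ _ → h0) (λ _ → h1) (λ _ → h2) (contradiction refl))
... | true  | true  | false | false = balanced (distinct-indices 0F 1F 2F 3F) h0 h1 h2 h3
... | true  | false | true  | false = balanced (distinct-indices 0F 2F 1F 3F) h0 h2 h1 h3
... | true  | false | false | true  = balanced (distinct-indices 0F 3F 1F 2F) h0 h3 h1 h2
... | false | true  | true  | false = balanced (distinct-indices 1F 2F 0F 3F) h1 h2 h0 h3
... | false | true  | false | true  = balanced (distinct-indices 1F 3F 0F 2F) h1 h3 h0 h2
... | false | false | true  | true  = balanced (distinct-indices 2F 3F 0F 1F) h2 h3 h0 h1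

-- The K₄ dichotomy says that a
-- Naji solution on K₄ has this property unless it is chordal.
Parity : (Fin 4 → Fin 4 → Bool) → Set
Parity t = ∀ p q r s → Distinct4 p q r s → t p r xor t q r ≢ t p s xor t q s

parity? : ∀ t → Dec (Parity t)
parity? t = all? λ p → all? λ q → all? λ r → all? λ s →
  distinct4? p q r s →-dec ¬? (t p r xor t q r ≟ᵇ t p s xor t q s)

parity-transfer : ∀ {t t'} → (∀ i j → i ≢ j → t i j ≡ t' i j) → Parity t' → Parity t
parity-transfer {t} {t'} t≡t' par p q r s d pr+qr≡ps+qs = par p q r s d (begin
    t' p r xor t' q r ≡⟨ sym (cong₂ _xor_ (t≡t' p r p≢r) (t≡t' q r q≢r)) ⟩
    t p r xor t q r   ≡⟨ pr+qr≡ps+qs ⟩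
    t p s xor t q s   ≡⟨ cong₂ _xor_ (t≡t' p s p≢s) (t≡t' q s q≢s) ⟩
    t' p s xor t' q s ∎)
  where open Distinct4 d

tournament : Vec Bool 6 → Fin 4 → Fin 4 → Bool
tournament (b01 ∷ b02 ∷ b03 ∷ b12 ∷ b13 ∷ b23 ∷ []) = t
  where
  t : Fin 4 → Fin 4 → Bool
  t 0F 1F = b01
  t 0F 2F = b02
  t 0F 3F = b03
  t 1F 2F = b12
  t 1F 3F = b13
  t 2F 3F = b23
  t 1F 0F = not b01
  t 2F 0F = not b02
  t 3F 0F = not b03
  t 2F 1F = not b12
  t 3F 1F = not b13
  t 3F 2F = not b23
  t _  _  = false

orientation : (Fin 4 → Fin 4 → Bool) → Vec Bool 6
orientation t = t 0F 1F ∷ t 0F 2F ∷ t 0F 3F ∷ t 1F 2F ∷ t 1F 3F ∷ t 2F 3F ∷ []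

tournament-orientation : ∀ t → (∀ i j → i ≢ j → t i j ≡ not (t j i)) →
                         ∀ i j → i ≢ j → t i j ≡ tournament (orientation t) i j
tournament-orientation t anti 0F 0F i≢j = contradiction refl i≢j
tournament-orientation t anti 1F 1F i≢j = contradiction refl i≢j
tournament-orientation t anti 2F 2F i≢j = contradiction refl i≢j
tournament-orientation t anti 3F 3F i≢j = contradiction refl i≢j
tournament-orientation t anti 0F 1F _   = refl
tournament-orientation t anti 0F 2F _   = refl
tournament-orientation t anti 0F 3F _   = refl
tournament-orientation t anti 1F 2F _   = refl
tournament-orientation t anti 1F 3F _   = refl
tournament-orientation t anti 2F 3F _   = refl
tournament-orientation t anti 1F 0F i≢j = anti 1F 0F i≢j
tournament-orientation t anti 2F 0F i≢j = anti 2F 0F i≢j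
tournament-orientation t anti 3F 0F i≢j = anti 3F 0F i≢j
tournament-orientation t anti 2F 1F i≢j = anti 2F 1F i≢j
tournament-orientation t anti 3F 1F i≢j = anti 3F 1F i≢j
tournament-orientation t anti 3F 2F i≢j = anti 3F 2F i≢j

-- In a chord diagram of K₄ the chords are pairwise crossing, so around the circle
-- the endpoints read c₀ c₁ c₂ c₃ c₀ c₁ c₂ c₃.  Up to rotation chord 0 comes first
-- with its head: the diagram is fixed by the order of chords 1–3 and their orientation.
interleaving : Vec ℕ 4 → Vec Bool 4 → Fin 4 × Bool → ℕ
interleaving pos tailFirst (c , isHead) =
  lookup pos c + (if isHead xor lookup tailFirst c then 0 else 4)

chordOrders : List (Vec ℕ 4)
chordOrders = (0 ∷ 1 ∷ 2 ∷ 3 ∷ []) ∷ (0 ∷ 1 ∷ 3 ∷ 2 ∷ []) ∷ (0 ∷ 2 ∷ 1 ∷ 3 ∷ []) ∷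
              (0 ∷ 2 ∷ 3 ∷ 1 ∷ []) ∷ (0 ∷ 3 ∷ 1 ∷ 2 ∷ []) ∷ (0 ∷ 3 ∷ 2 ∷ 1 ∷ []) ∷ []

endpointMaps : List (Fin 4 × Bool → ℕ)
endpointMaps = concatMap (λ pos → map (λ o → interleaving pos (false ∷ o)) (allVecs 3)) chordOrders

injective? : (E : Fin 4 × Bool → ℕ) → Dec (Injective _≡_ _≡_ E)
injective? E = map′ (λ h {(c , b)} {(c' , b')} → h c b c' b') (λ h c b c' b' → h)
  (all? λ c → ∀-Bool? λ b → all? λ c' → ∀-Bool? λ b' →
     (E (c , b) ≟ℕ E (c' , b')) →-dec ≡-dec _≟_ _≟ᵇ_ (c , b) (c' , b'))

endpointMaps-injective : All (Injective _≡_ _≡_) endpointMaps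
endpointMaps-injective = from-yes (All.all? injective? endpointMaps)

k4Diagrams : List (ChordDiagram 4)
k4Diagrams = mapWith∈ endpointMaps λ {E} E∈ →
  record { endpoint = E ; distinct = All.lookup endpointMaps-injective E∈ }

Realizes : (Fin 4 → Fin 4 → Bool) → ChordDiagram 4 → Set
Realizes t D = (∀ i j → i ≢ j → crosses D i j ≡ true) × (∀ i j → i ≢ j → t i j ≡ βC D i j)

realizes? : ∀ t D → Dec (Realizes t D)
realizes? t D = (all? λ i → all? λ j → ¬? (i ≟ j) →-dec (crosses D i j ≟ᵇ true))
          ×-dec (all? λ i → all? λ j → ¬? (i ≟ j) →-dec (t i j ≟ᵇ βC D i j))

dichotomy : ∀ v → Parity (tournament v) ⊎ Any (Realizes (tournament v)) k4Diagrams
dichotomy = from-yes (∀-Vec? 6 λ v → parity? (tournament v) ⊎-dec Any.any? (realizes? (tournament v)) k4Diagrams)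

adj-sym : ∀ {n} (G : Graph n) {u v b} → adj G u v ≡ b → adj G v u ≡ b
adj-sym G {u} {v} uv = trans (Graph.sym G v u) uv

adj⇒≢ : ∀ {n} (G : Graph n) {u v} → adj G u v ≡ true → u ≢ v
adj⇒≢ G {u} uv refl = contradiction (trans (sym uv) (Graph.irrefl G u)) λ ()

view : ∀ {n} → (Fin n → Fin n → Bool) → Fin n → Fin n → Fin n → Bool
view β P Q u = β P u xor β Q u

module NajiFacts {n} {G : Graph n} {β : Fin n → Fin n → Bool} (N : NajiSolution G β) where
  open NajiSolution N

  private
    A = adj G
    variable
      u v P Q : Fin n

  shift : Fin n → Fin n → Fin n → Bool
  shift P u v = β P u xor β P v

  views-alike : shift P u v ≡ shift Q u v → view β P Q u ≡ view β P Q v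
  views-alike {P = P} {u = u} {v = v} {Q = Q} = xor-swap (β P u) (β P v) (β Q u) (β Q v)

  shift-far : A u v ≡ true → A P u ≡ false → A P v ≡ false → P ≢ u → P ≢ v → shift P u v ≡ false
  shift-far {u = u} {v = v} {P = P} uv Pu Pv P≢u P≢v = eqOut P u v P≢u P≢v (adj⇒≢ G uv) uv Pu Pv

  shift-common : A u v ≡ false → u ≢ v → A P u ≡ true → A P v ≡ true → shift P u v ≡ not (β u v xor β v u)
  shift-common {u = u} {v = v} {P = P} uv u≢v Pu Pv = xor≡true⇒≡not (eqIn P u v (adj⇒≢ G Pu) (adj⇒≢ G Pv) u≢v Pu Pv uv)

  shift-pendant : A u v ≡ true → A v P ≡ true → A u P ≡ false → u ≢ P → shift P u v ≡ β u P xor β v u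
  shift-pendant {u = u} {v = v} {P = P} uv vP uP u≢P =
    pendant-law (β u P) (β P u) (β v u) (β v P) (β P v)
      (eqIn v u P (≢-sym (adj⇒≢ G uv)) (adj⇒≢ G vP) u≢P (adj-sym G uv) vP uP) (eqEdge v P vP)

  view-across-edge : ∀ b → A u v ≡ true → A P Q ≡ true → A u P ≡ false → A u Q ≡ false →
                     A v P ≡ b → A v Q ≡ b → u ≢ P → u ≢ Q → v ≢ P → v ≢ Q →
                     view β P Q u ≡ view β P Q v
  view-across-edge {u = u} {v = v} {P = P} {Q = Q} false uv _ uP uQ vP vQ u≢P u≢Q v≢P v≢Q = views-alike (begin
    shift P u v ≡⟨ shift-far uv (adj-sym G uP) (adj-sym G vP) (≢-sym u≢P) (≢-sym v≢P) ⟩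
    false       ≡⟨ sym (shift-far uv (adj-sym G uQ) (adj-sym G vQ) (≢-sym u≢Q) (≢-sym v≢Q)) ⟩
    shift Q u v ∎)
  view-across-edge {u = u} {v = v} {P = P} {Q = Q} true uv PQ uP uQ vP vQ u≢P u≢Q _ _ = views-alike (begin
    shift P u v     ≡⟨ shift-pendant uv vP uP u≢P ⟩
    β u P xor β v u ≡⟨ cong (_xor β v u) (xor≡false⇒≡ (β u P) (β u Q) (eqOut u P Q u≢P u≢Q (adj⇒≢ G PQ) PQ uP uQ)) ⟩
    β u Q xor β v u ≡⟨ sym (shift-pendant uv vQ uQ u≢Q) ⟩
    shift Q u v     ∎)

  view-across-nonedge : A u v ≡ false → u ≢ v → A P u ≡ true → A P v ≡ true →
                        A Q u ≡ true → A Q v ≡ true → view β P Q u ≡ view β P Q v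
  view-across-nonedge uv u≢v Pu Pv Qu Qv =
    views-alike (trans (shift-common uv u≢v Pu Pv) (sym (shift-common uv u≢v Qu Qv)))

nonchordal⇒parity : ∀ {n} {G : Graph n} {β} {e : Fin 4 → Fin n} → NajiSolution G β → InducedK4 G e →
                    ¬ ChordalOn G β e → Parity (λ i j → β (e i) (e j))
nonchordal⇒parity {G = G} {β} {e} N (_ , e-adj) nonchordal = by-dichotomy (dichotomy (orientation t))
  where
  t : Fin 4 → Fin 4 → Bool
  t i j = β (e i) (e j)

  t≡tournament : ∀ i j → i ≢ j → t i j ≡ tournament (orientation t) i j
  t≡tournament = tournament-orientation t λ i j i≢j →
    xor≡true⇒≡not (NajiSolution.eqEdge N (e j) (e i) (e-adj j i (≢-sym i≢j)))

  by-dichotomy : Parity (tournament (orientation t)) ⊎ Any (Realizes (tournament (orientation t))) k4Diagrams →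
                 Parity t
  by-dichotomy (inj₁ parity) = parity-transfer t≡tournament parity
  by-dichotomy (inj₂ realized) = contradiction (chordal (Any.satisfied realized)) nonchordal
    where
    chordal : ∃ (Realizes (tournament (orientation t))) → ChordalOn G β e
    chordal (D , crossing , matching) =
      D , (λ i j i≢j → trans (crossing i j i≢j) (sym (e-adj i j i≢j)))
        , (λ i j i≢j → trans (t≡tournament i j i≢j) (matching i j i≢j))

module Representatives {n} (G : Graph n) (β : Fin n → Fin n → Bool) (N : NajiSolution G β)
  (e : Fin 4 → Fin n) (K : InducedK4 G e) (parity : Parity (λ i j → β (e i) (e j))) where
  open NajiFacts N

  private
    A = adj G
    variable
      u v : Fin n
      p q r t : Fin 4
      b : Bool

  e-injective : Injective _≡_ _≡_ e
  e-injective = proj₁ K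

  e-adjacent : p ≢ q → A (e p) (e q) ≡ true
  e-adjacent {p} {q} = proj₂ K p q

  seen : Fin 4 → Fin 4 → Fin n → Bool
  seen p q = view β (e p) (e q)

  Outside : Fin n → Set
  Outside u = ∀ h → u ≢ e h

  Avoids : Fin n → Fin 4 → Set
  Avoids u r = ∀ h → h ≢ r → u ≢ e h

  Uniform : Fin n → Fin 4 → Bool → Set
  Uniform u r b = ∀ h → h ≢ r → A u (e h) ≡ b

  Agrees : Fin n → Fin 4 → Set
  Agrees u r = ∀ p q → p ≢ r → q ≢ r → p ≢ q → seen p q u ≡ seen p q (e r)

  record Represents (u : Fin n) (r : Fin 4) : Set where
    constructor represents
    field
      avoids  : Avoids u r
      uniform : Σ Bool (Uniform u r)
      agrees  : Agrees u r
  open Represents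

  represents? : ∀ u r → Dec (Represents u r)
  represents? u r =
    map′ (λ (a , c , g) → represents a c g) (λ (represents a c g) → a , c , g)
      ((all? λ h → ¬? (h ≟ r) →-dec ¬? (u ≟ e h))
       ×-dec (∃-Bool? λ b → all? λ h → ¬? (h ≟ r) →-dec (A u (e h) ≟ᵇ b))
       ×-dec (all? λ p → all? λ q → ¬? (p ≟ r) →-dec (¬? (q ≟ r) →-dec (¬? (p ≟ q) →-dec
                (seen p q u ≟ᵇ seen p q (e r))))))

  e-uniform : ∀ r → Uniform (e r) r true
  e-uniform r h h≢r = e-adjacent (≢-sym h≢r)

  represents-self : ∀ r → Represents (e r) r
  represents-self r =
    represents (λ h h≢r er≡eh → h≢r (sym (e-injective er≡eh))) (true , e-uniform r) (λ _ _ _ _ _ → refl)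

  distinguished : Represents u r → Represents v t → r ≢ t →
                  ∃₂ λ p q → Distinct4 p q r t × seen p q u ≢ seen p q v
  distinguished {u = u} {r = r} {v = v} {t = t} ρ σ r≢t =
    let p , q , d = others r t r≢t
        open Distinct4 d
    in p , q , d , λ u≈v → parity p q r t d (begin
         seen p q (e r) ≡⟨ sym (agrees ρ p q p≢r q≢r p≢q) ⟩
         seen p q u     ≡⟨ u≈v ⟩
         seen p q v     ≡⟨ agrees σ p q p≢s q≢s p≢q ⟩
         seen p q (e t) ∎)

  edge-agree : A u v ≡ true → Avoids u t → Uniform u t false → Avoids v r → Uniform v r b →
               p ≢ q → p ≢ t → q ≢ t → p ≢ r → q ≢ r → seen p q u ≡ seen p q v
  edge-agree {b = b} {p = p} {q = q} uv au ut av vr p≢q p≢t q≢t p≢r q≢r =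
    view-across-edge b uv (e-adjacent p≢q) (ut p p≢t) (ut q q≢t) (vr p p≢r) (vr q q≢r)
      (au p p≢t) (au q q≢t) (av p p≢r) (av q q≢r)

  nonedge-agree : A u v ≡ false → u ≢ v → Uniform u t true → Uniform v r true →
                  p ≢ t → q ≢ t → p ≢ r → q ≢ r → seen p q u ≡ seen p q v
  nonedge-agree {p = p} {q = q} uv u≢v ut vr p≢t q≢t p≢r q≢r =
    view-across-nonedge uv u≢v (adj-sym G (ut p p≢t)) (adj-sym G (vr p p≢r))
                               (adj-sym G (ut q q≢t)) (adj-sym G (vr q q≢r))

  inherit : Outside v → Uniform v r b → Represents u r →
            (∀ {p q} → p ≢ r → q ≢ r → p ≢ q → seen p q v ≡ seen p q u) → Represents v r
  inherit {b = b} out vr ρ v≈u =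
    represents (λ h _ → out h) (b , vr) λ p q p≢r q≢r p≢q → trans (v≈u p≢r q≢r p≢q) (agrees ρ p q p≢r q≢r p≢q)

  singular-represents : Outside v → ∀ {a} b → A v (e a) ≡ b → Uniform v a (not b) → Represents v a
  singular-represents out {a} true va others-missed = inherit out others-missed (represents-self a)
    λ p≢a q≢a p≢q → edge-agree va (λ h _ → out h) others-missed (avoids (represents-self a)) (e-uniform a)
                      p≢q p≢a q≢a p≢a q≢a
  singular-represents out {a} false va others-seen = inherit out others-seen (represents-self a)
    λ p≢a q≢a _ → nonedge-agree va (out a) others-seen (e-uniform a) p≢a q≢a p≢a q≢a

  -- No vertex outside H sees exactly two vertices of H: that pair would see the
  -- other two alike.
  no-two-neighbours : ∀ {p q r s} → Outside v → Distinct4 p q r s → A v (e p) ≡ true → A v (e q) ≡ true →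
                      A v (e r) ≡ false → A v (e s) ≡ false → ⊥
  no-two-neighbours {v = v} {p = p} {q = q} {r = r} {s = s} out d vp vq vr vs =
    parity p q r s d (trans (sym (seen-like r p≢r q≢r vr)) (seen-like s p≢s q≢s vs))
    where
    open Distinct4 d
    seen-like : ∀ x → p ≢ x → q ≢ x → A v (e x) ≡ false → seen p q v ≡ seen p q (e x)
    seen-like x p≢x q≢x vx = view-across-nonedge vx (out x) (adj-sym G vp) (e-adjacent p≢x)
                                                          (adj-sym G vq) (e-adjacent q≢x)

  Classification : Fin n → Fin 4 → Set
  Classification v r = Σ Bool (Uniform v r) ⊎ Σ (Fin 4) (λ t → t ≢ r × Represents v t)

  classify : Outside v → ∀ r → Classification v r
  classify {v = v} out r with shape (λ h → A v (e h))
  ... | constant b vH = inj₁ (b , λ h _ → vH h)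
  ... | balanced d vp vq vr vs = ⊥-elim (no-two-neighbours out d vp vq vr vs)
  ... | singular a b va others with a ≟ r
  ...   | yes refl = inj₁ (not b , others)
  ...   | no a≢r   = inj₂ (a , a≢r , singular-represents out b va others)

  outside-neighbour : Uniform u r false → A u v ≡ true → v ≢ e r → Outside v
  outside-neighbour {r = r} missed uv v≢er h with h ≟ r
  ... | yes refl = v≢er
  ... | no h≢r   = λ { refl → contradiction (trans (sym uv) (missed h h≢r)) λ () }

  propagate : Represents u r → Uniform u r false → A u v ≡ true → Represents v r
  propagate {u = u} {r = r} {v = v} ρ missed uv with v ≟ e r
  ... | yes refl = represents-self r
  ... | no v≢er  = from-classification (classify out r)
    where
    out = outside-neighbour missed uv v≢er
    from-classification : Classification v r → Represents v r
    from-classification (inj₁ (b , vr)) = inherit out vr ρ λ p≢r q≢r p≢q →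
      sym (edge-agree uv (avoids ρ) missed (λ h _ → out h) vr p≢q p≢r q≢r p≢r q≢r)
    from-classification (inj₂ (t , t≢r , σ)) =
      let p , q , d , u≉v = distinguished ρ σ (≢-sym t≢r)
          open Distinct4 d
      in contradiction (edge-agree uv (avoids ρ) missed (avoids σ) (proj₂ (uniform σ)) p≢q p≢r q≢r p≢s q≢s) u≉v

  module Extension (Y : Subset 4) where

    Claimed : Fin n → Set
    Claimed u = Σ (Fin 4) λ r → r ∈ Y × Represents u r

    claimed? : ∀ u → Dec (Claimed u)
    claimed? u = any? λ r → (r ∈? Y) ×-dec represents? u r

    Contact : Fin n → Set
    Contact u = (Σ (Fin 4) λ t → t ∉ Y × Represents u t × Uniform u t true) ⊎ (Outside u × ∀ h → A u (e h) ≡ true)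

    frontier : Represents v r → r ∈ Y → A v u ≡ true → ¬ Claimed u → Uniform v r true
    frontier ρ r∈Y vu unclaimed with uniform ρ
    ... | true  , vr = vr
    ... | false , vr = ⊥-elim (unclaimed (_ , r∈Y , propagate ρ vr vu))

    unclaimed-neighbour : ¬ Claimed u → A u v ≡ true → Represents v r → r ∈ Y → Uniform v r true → Contact u
    unclaimed-neighbour {u = u} {v = v} {r = r} unclaimed uv ρ r∈Y vr with any? (λ h → u ≟ e h)
    ... | yes (h , refl) = inj₁ (h , (λ h∈Y → unclaimed (h , h∈Y , represents-self h)) , represents-self h , e-uniform h)
    ... | no not-in-H    = from-classification (classify out r)
      where
      out : Outside u
      out h u≡eh = not-in-H (h , u≡eh)

      claim : Represents u r → ⊥
      claim ρu = unclaimed (r , r∈Y , ρu)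

      full : Uniform u r true → A u (e r) ≡ true → ∀ h → A u (e h) ≡ true
      full ur ue h with h ≟ r
      ... | yes refl = ue
      ... | no h≢r   = ur h h≢r

      from-classification : Classification u r → Contact u
      from-classification (inj₁ (true , ur)) with A u (e r) in ue
      ... | true  = inj₂ (out , full ur ue)
      ... | false = ⊥-elim (claim (singular-represents out false ue ur))
      from-classification (inj₁ (false , ur)) = ⊥-elim (claim (inherit out ur ρ λ p≢r q≢r p≢q →
        edge-agree uv (λ h _ → out h) ur (avoids ρ) vr p≢q p≢r q≢r p≢r q≢r))
      from-classification (inj₂ (t , t≢r , σ)) with uniform σ | t ∈? Y
      ... | _ , _ | yes t∈Y = ⊥-elim (unclaimed (t , t∈Y , σ))
      ... | true , ut | no t∉Y = inj₁ (t , t∉Y , σ , ut)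
      ... | false , ut | no _ =
        let p , q , d , v≉u = distinguished ρ σ (≢-sym t≢r)
            open Distinct4 d
        in contradiction (sym (edge-agree uv (avoids σ) ut (avoids ρ) vr p≢q p≢s q≢s p≢r q≢r)) v≉u

    claimed-complete : ∀ {x y} → ¬ Claimed x → Claimed y →
      (Σ (Fin n) λ y' → Claimed y' × A x y' ≡ true) → (Σ (Fin n) λ x' → ¬ Claimed x' × A x' y ≡ true) →
      A x y ≡ true
    claimed-complete {x} {y} x-unclaimed (r , r∈Y , ρ) (y' , (r' , r'∈Y , ρ') , xy') (x' , x'-unclaimed , x'y)
      with A x y in xy
    ... | true  = refl
    ... | false = ⊥-elim (nonadjacent (unclaimed-neighbour x-unclaimed xy' ρ' r'∈Y
                                         (frontier ρ' r'∈Y (adj-sym G xy') x-unclaimed)))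
      where
      x≢y : x ≢ y
      x≢y refl = x-unclaimed (r , r∈Y , ρ)

      yr : Uniform y r true
      yr = frontier ρ r∈Y (adj-sym G x'y) x'-unclaimed

      nonadjacent : Contact x → ⊥
      nonadjacent (inj₁ (t , t∉Y , σ , xt)) =
        let p , q , d , x≉y = distinguished σ ρ (λ { refl → t∉Y r∈Y })
            open Distinct4 d
        in x≉y (nonedge-agree xy x≢y xt yr p≢r q≢r p≢s q≢s)
      nonadjacent (inj₂ (out , xH)) = x-unclaimed (r , r∈Y , inherit out (λ h _ → xH h) ρ λ p≢r q≢r _ →
        nonedge-agree xy x≢y (λ h _ → xH h) yr p≢r q≢r p≢r q≢r)

    X' : Subset n
    X' = select (λ u → ¬? (claimed? u))

    unclaimed⇒∈X' : ¬ Claimed u → u ∈ X'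
    unclaimed⇒∈X' = ∈-select (λ u → ¬? (claimed? u))

    ∈X'⇒unclaimed : u ∈ X' → ¬ Claimed u
    ∈X'⇒unclaimed = ∈-select⁻ (λ u → ¬? (claimed? u))

    claimed⇒∈∁X' : Claimed u → u ∈ ∁ X'
    claimed⇒∈∁X' claimed = x∉p⇒x∈∁p (λ u∈X' → ∈X'⇒unclaimed u∈X' claimed)

    ∈∁X'⇒claimed : u ∈ ∁ X' → Claimed u
    ∈∁X'⇒claimed {u} u∈∁X' = decidable-stable (claimed? u) λ unclaimed → x∈∁p⇒x∉p u∈∁X' (unclaimed⇒∈X' unclaimed)

    X'-complete : ∀ x y → x ∈ X' → y ∈ ∁ X' → (∃ λ y' → y' ∈ ∁ X' × A x y' ≡ true) →
                  (∃ λ x' → x' ∈ X' × A x' y ≡ true) → A x y ≡ true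
    X'-complete x y x∈X' y∈∁X' (y' , y'∈∁X' , xy') (x' , x'∈X' , x'y) =
      claimed-complete (∈X'⇒unclaimed x∈X') (∈∁X'⇒claimed y∈∁X')
                       (y' , ∈∁X'⇒claimed y'∈∁X' , xy') (x' , ∈X'⇒unclaimed x'∈X' , x'y)

    e-claimed : ∀ {i} → i ∈ Y → Claimed (e i)
    e-claimed {i} i∈Y = i , i∈Y , represents-self i

    e-unclaimed : ∀ {i} → i ∉ Y → ¬ Claimed (e i)
    e-unclaimed {i} i∉Y (r , r∈Y , ρ) with i ≟ r
    ... | yes refl = i∉Y r∈Y
    ... | no i≢r   = avoids ρ i i≢r refl

lemma4p2 : ∀ {n} (G : Graph n) (β : Fin n → Fin n → Bool) → NajiSolution G β →
    (e : Fin 4 → Fin n) → InducedK4 G e → ¬ ChordalOn G β e →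
    (X : Subset 4) → IsSplit (λ i j → adj G (e i) (e j)) X →
    Σ (Subset n) λ X' → IsSplit (adj G) X' ×
      (∀ i → i ∈ X → e i ∈ X') × (∀ i → i ∈ ∁ X → e i ∈ ∁ X')
lemma4p2 G β N e K nonchordal X (2≤∣X∣ , 2≤∣∁X∣ , _) =
    X' , (image-size e-injective X 2≤∣X∣ X↦X' , image-size e-injective (∁ X) 2≤∣∁X∣ ∁X↦∁X' , X'-complete)
       , X↦X' , ∁X↦∁X'
  where
  open Representatives G β N e K (nonchordal⇒parity N K nonchordal)
  open Extension (∁ X)

  X↦X' : ∀ i → i ∈ X → e i ∈ X'
  X↦X' i i∈X = unclaimed⇒∈X' (e-unclaimed (x∈p⇒x∉∁p i∈X))

  ∁X↦∁X' : ∀ i → i ∈ ∁ X → e i ∈ ∁ X'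
  ∁X↦∁X' i i∈∁X = claimed⇒∈∁X' (e-claimed i∈∁X)
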